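{- For a bipartite poset $P=A\cup B$, $\dim^*(P)\le 2+\operatorname{Idim}^*(P)$.
   Context: A bipartite poset is a finite poset $P$ with a partition $P=A\cup B$ where $A\subseteq\operatorname{Min}(P)$ and $B\subseteq\operatorname{Max}(P)$. Let $L_1,\dots,L_N$ be all linear extensions of $P$. The fractional dimension $\dim^*(P)$ is the least real $d$ such that there are non-negative reals $\alpha_1,\dots,\alpha_N$ with $\sum_i\alpha_i=d$ and, for every pair $(x,y)$ of incomparable elements of $P$, $\sum\{\alpha_i: x>y \text{ in } L_i\}\ge1$. $\operatorname{Idim}^*(P)$ is the least real $d\ge0$ such that there are non-negative reals $\alpha_1,\dots,\alpha_N$ with $\sum_i\alpha_i=d$ and, for every $(a,b)\in A\times B$ with $a\parallel b$ in $P$, $\sum\{\alpha_i: a>b\text{ in }L_i\}\ge1$.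
   Formalization: The weights $\alpha_1,\dots,\alpha_N$ are non-negative rationals rather than non-negative reals, and the bound d on $\operatorname{Idim}^*(P)$ is rational. -}

module Defs where

open import Data.Nat using (ℕ)
open import Data.Fin using (Fin) renaming (_≤_ to _≤F_; _<_ to _<F_)
open import Data.Fin.Properties using () renaming (_<?_ to _<F?_)
open import Data.Bool using (Bool; true; false)
open import Data.List using (List; []; _∷_)
open import Data.Product using (Σ; _×_; _,_; proj₁; proj₂; ∃-syntax)
open import Data.Rational using (ℚ; 0ℚ; 1ℚ; _+_; _≤_)
open import Relation.Nullary using (¬_; yes; no)
open import Relation.Binary.PropositionalEquality using (_≡_)
open import Relation.Binary.Structures using (IsPartialOrder)
open import Function.Definitions using (Injective)
open import Data.Unit using (⊤)

record FinPoset (n : ℕ) : Set₁ where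
  field
    _≼_ : Fin n → Fin n → Set
    isPartialOrder : IsPartialOrder _≡_ _≼_
open FinPoset public

module _ {n : ℕ} (P : FinPoset n) where
  private _≼P_ = _≼_ P

  Incomparable : Fin n → Fin n → Set
  Incomparable x y = ¬ (x ≼P y) × ¬ (y ≼P x)

  IsMinimal IsMaximal : Fin n → Set
  IsMinimal a = ∀ x → x ≼P a → x ≡ a
  IsMaximal b = ∀ x → b ≼P x → x ≡ b

  -- Bipartite structure: inA x = true means x ∈ A, otherwise x ∈ B.
  -- P = A ∪ B is a partition, A ⊆ Min(P), B ⊆ Max(P).
  IsBipartite : (Fin n → Bool) → Set
  IsBipartite inA = (∀ a → inA a ≡ true → IsMinimal a)
                  × (∀ b → inA b ≡ false → IsMaximal b)

  -- A linear extension L, given by the position pos x of each element: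
  -- pos is injective (hence a bijection Fin n → Fin n) and order-preserving.
  record LinExt : Set where
    field
      pos : Fin n → Fin n
      pos-injective : Injective _≡_ _≡_ pos
      pos-monotone : ∀ {x y} → x ≼P y → pos x ≤F pos y
  open LinExt public

  _>[_]_ : Fin n → LinExt → Fin n → Set
  x >[ L ] y = pos L y <F pos L x

  -- A weighted family of linear extensions (the weights α_i;
  -- extensions not listed get weight 0; repeats add up).
  WFamily : Set
  WFamily = List (LinExt × ℚ)

  totalWeight : WFamily → ℚ
  totalWeight [] = 0ℚ
  totalWeight ((L , w) ∷ F) = w + totalWeight F

  NonNeg : WFamily → Set
  NonNeg [] = ⊤
  NonNeg ((L , w) ∷ F) = (0ℚ ≤ w) × NonNeg F

  revWeight : WFamily → Fin n → Fin n → ℚ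
  revWeight [] x y = 0ℚ
  revWeight ((L , w) ∷ F) x y with pos L y <F? pos L x
  ... | yes _ = w + revWeight F x y
  ... | no  _ = revWeight F x y

  DimRealizer : WFamily → Set
  DimRealizer F = NonNeg F × (∀ x y → Incomparable x y → 1ℚ ≤ revWeight F x y)

  IdimRealizer : (Fin n → Bool) → WFamily → Set
  IdimRealizer inA F = NonNeg F
    × (∀ a b → inA a ≡ true → inA b ≡ false → Incomparable a b → 1ℚ ≤ revWeight F a b)

  -- dim*(P) ≤ d   (the LP minimum is attained)
  FracDimAtMost : ℚ → Set
  FracDimAtMost d = ∃[ F ] DimRealizer F × (totalWeight F ≤ d)

  IdimAtMost : (Fin n → Bool) → ℚ → Set
  IdimAtMost inA d = ∃[ F ] IdimRealizer inA F × (totalWeight F ≤ d)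

-- List A before B, inside each block either by increasing index ("ascending") or by decreasing
-- index ("descending"). Both are linear extensions, since every strict comparability of a
-- bipartite poset goes from A to B. An incomparable pair inside one block is reversed by one
-- of them and a pair in B × A by both, so only the pairs in A × B are left, and those are what
-- an Idim* realizer reverses: adding the two extensions with weight 1 each turns an Idim*
-- realizer of weight d into a dim* realizer of weight 2 + d.
module Submission where

open import Defs
open import Data.Nat using (ℕ; _<ᵇ_; s<s) renaming (_+_ to _+ℕ_; _<_ to _<ℕ_)
import Data.Nat.Properties as ℕ
open import Data.Fin using (Fin; toℕ; fromℕ<; opposite) renaming (_<_ to _<F_; _≤_ to _≤F_)
import Data.Fin.Properties as FinP
open import Data.Fin.Subset using (Subset; _∈_; _⊂_; ⊤; ∣_∣)
open import Data.Fin.Subset.Properties using (p⊂q⇒∣p∣<∣q∣; ∣⊤∣≡n; ∈⊤; ⊆⊤)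
open import Data.Vec using (tabulate)
open import Data.Vec.Properties using (lookup∘tabulate; []=⇒lookup; lookup⇒[]=)
open import Data.Bool using (Bool; true; false)
open import Data.Bool.Properties using (T-≡)
open import Data.Empty using (⊥-elim)
open import Data.List using ([]; _∷_)
open import Data.Sum using (_⊎_; inj₁; inj₂; [_,_]′)
open import Data.Product using (_×_; _,_; proj₁; proj₂)
open import Data.Rational using (ℚ; 0ℚ; 1ℚ; _+_; _≤_)
import Data.Rational.Properties as ℚ
open import Function using (Equivalence; id)
open import Function.Definitions using (Injective)
open import Relation.Nullary using (¬_; yes; no)
open import Relation.Binary using (tri<; tri≈; tri>)
open import Relation.Binary.PropositionalEquality using (_≡_; _≢_; refl; sym; trans; cong; subst; subst₂)
open import Relation.Binary.Structures using (IsPartialOrder)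

private
  variable
    n : ℕ

0≤1 : 0ℚ ≤ 1ℚ
0≤1 = ℚ.≤ᵇ⇒≤ _

≤-+-nonNeg : ∀ {w p q} → 0ℚ ≤ w → p ≤ q → p ≤ w + q
≤-+-nonNeg {p = p} 0≤w p≤q = ℚ.≤-trans (ℚ.≤-reflexive (sym (ℚ.+-identityˡ p))) (ℚ.+-mono-≤ 0≤w p≤q)

opposite-reverses-< : {i j : Fin n} → toℕ i <ℕ toℕ j → toℕ (opposite j) <ℕ toℕ (opposite i)
opposite-reverses-< {n} {i} {j} i<j rewrite FinP.opposite-prop i | FinP.opposite-prop j =
  ℕ.∸-monoʳ-< (s<s i<j) (FinP.toℕ<n j)

opposite-injective : Injective _≡_ _≡_ (opposite {n})
opposite-injective {x = i} {j} eq =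
  trans (sym (FinP.opposite-involutive i)) (trans (cong opposite eq) (FinP.opposite-involutive j))

module Ranking (key : Fin n → ℕ) where

  keysBelow : Fin n → Subset n
  keysBelow x = tabulate (λ z → key z <ᵇ key x)

  ∈-keysBelow⁻ : ∀ {z x} → z ∈ keysBelow x → key z <ℕ key x
  ∈-keysBelow⁻ {z} {x} z∈ = ℕ.<ᵇ⇒< (key z) (key x)
    (Equivalence.from T-≡ (trans (sym (lookup∘tabulate _ z)) ([]=⇒lookup z∈)))

  ∈-keysBelow⁺ : ∀ {z x} → key z <ℕ key x → z ∈ keysBelow x
  ∈-keysBelow⁺ {z} z<x = lookup⇒[]= z _ (trans (lookup∘tabulate _ z) (Equivalence.to T-≡ (ℕ.<⇒<ᵇ z<x)))

  x∉keysBelow-x : ∀ x → ¬ x ∈ keysBelow x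
  x∉keysBelow-x x x∈ = ℕ.<-irrefl refl (∈-keysBelow⁻ x∈)

  keysBelow-⊂ : ∀ {x y} → key x <ℕ key y → keysBelow x ⊂ keysBelow y
  keysBelow-⊂ {x} x<y = (λ z∈ → ∈-keysBelow⁺ (ℕ.<-trans (∈-keysBelow⁻ z∈) x<y))
                      , x , ∈-keysBelow⁺ x<y , x∉keysBelow-x x

  ∣keysBelow∣<n : ∀ x → ∣ keysBelow x ∣ <ℕ n
  ∣keysBelow∣<n x = subst (∣ keysBelow x ∣ <ℕ_) (∣⊤∣≡n n) (p⊂q⇒∣p∣<∣q∣ (⊆⊤ , x , ∈⊤ , x∉keysBelow-x x))

  rank : Fin n → Fin n
  rank x = fromℕ< (∣keysBelow∣<n x)

  rank-mono : ∀ {x y} → key x <ℕ key y → rank x <F rank y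
  rank-mono {x} {y} x<y = subst₂ _<ℕ_
    (sym (FinP.toℕ-fromℕ< (∣keysBelow∣<n x))) (sym (FinP.toℕ-fromℕ< (∣keysBelow∣<n y)))
    (p⊂q⇒∣p∣<∣q∣ (keysBelow-⊂ x<y))

  rank-injective : Injective _≡_ _≡_ key → Injective _≡_ _≡_ rank
  rank-injective key-inj {x} {y} eq with ℕ.<-cmp (key x) (key y)
  ... | tri< x<y _ _ = ⊥-elim (FinP.<-irrefl eq (rank-mono x<y))
  ... | tri≈ _ x≡y _ = key-inj x≡y
  ... | tri> _ _ y<x = ⊥-elim (FinP.<-irrefl (sym eq) (rank-mono y<x))

module _ (P : FinPoset n) where
  private
    _≼P_ = _≼_ P

  linExtOfKey : (key : Fin n → ℕ) → Injective _≡_ _≡_ key →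
    (∀ {x y} → x ≼P y → x ≢ y → key x <ℕ key y) → LinExt P
  linExtOfKey key key-inj key-mono = record
    { pos = rank ; pos-injective = rank-injective key-inj ; pos-monotone = rank-≼ }
    where
    open Ranking key
    rank-≼ : ∀ {x y} → x ≼P y → rank x ≤F rank y
    rank-≼ {x} {y} x≼y with x FinP.≟ y
    ... | yes refl = ℕ.≤-refl
    ... | no x≢y = ℕ.<⇒≤ (rank-mono (key-mono x≼y x≢y))

  linExtOfKey-reverses : (key : Fin n → ℕ) (key-inj : Injective _≡_ _≡_ key)
    (key-mono : ∀ {x y} → x ≼P y → x ≢ y → key x <ℕ key y) →
    ∀ {x y} → key y <ℕ key x → _>[_]_ P x (linExtOfKey key key-inj key-mono) y
  linExtOfKey-reverses key _ _ = Ranking.rank-mono key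

  revWeight-nonNeg : ∀ F x y → NonNeg P F → 0ℚ ≤ revWeight P F x y
  revWeight-nonNeg [] x y _ = ℚ.≤-refl
  revWeight-nonNeg ((L , w) ∷ F) x y (0≤w , F≥0) with pos L y FinP.<? pos L x
  ... | yes _ = ≤-+-nonNeg 0≤w (revWeight-nonNeg F x y F≥0)
  ... | no _ = revWeight-nonNeg F x y F≥0

  revWeight-∷-≥ : ∀ L {w} F x y → 0ℚ ≤ w → revWeight P F x y ≤ revWeight P ((L , w) ∷ F) x y
  revWeight-∷-≥ L F x y 0≤w with pos L y FinP.<? pos L x
  ... | yes _ = ≤-+-nonNeg 0≤w ℚ.≤-refl
  ... | no _ = ℚ.≤-refl

  revWeight-∷-reversed : ∀ L w F {x y} → NonNeg P F → _>[_]_ P x L y → w ≤ revWeight P ((L , w) ∷ F) x y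
  revWeight-∷-reversed L w F {x} {y} F≥0 x>y with pos L y FinP.<? pos L x
  ... | yes _ = ℚ.≤-trans (ℚ.≤-reflexive (sym (ℚ.+-identityʳ w))) (ℚ.+-monoʳ-≤ w (revWeight-nonNeg F x y F≥0))
  ... | no x≯y = ⊥-elim (x≯y x>y)

  incomparable⇒≢ : ∀ {x y} → Incomparable P x y → x ≢ y
  incomparable⇒≢ (x⋠y , _) refl = x⋠y (IsPartialOrder.refl (isPartialOrder P))

module Bipartite (P : FinPoset n) (inA : Fin n → Bool) (bip : IsBipartite P inA) where
  private
    _≼P_ = _≼_ P

  ≺⇒A-below-B : ∀ {x y} → x ≼P y → x ≢ y → inA x ≡ true × inA y ≡ false
  ≺⇒A-below-B {x} {y} x≼y x≢y with inA x in ex | inA y in ey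
  ... | true  | false = refl , refl
  ... | true  | true  = ⊥-elim (x≢y (proj₁ bip y ey x x≼y))
  ... | false | _     = ⊥-elim (x≢y (sym (proj₂ bip x ex y x≼y)))

  blockOffset : Bool → ℕ
  blockOffset true  = 0
  blockOffset false = n

  blockKey : (Fin n → Fin n) → Fin n → ℕ
  blockKey σ x = blockOffset (inA x) +ℕ toℕ (σ x)

  offset-separates : ∀ (i j : Fin n) → toℕ i <ℕ n +ℕ toℕ j
  offset-separates i j = ℕ.<-≤-trans (FinP.toℕ<n i) (ℕ.m≤m+n n (toℕ j))

  blockKey-A<B : ∀ σ {x y} → inA x ≡ true → inA y ≡ false → blockKey σ x <ℕ blockKey σ y
  blockKey-A<B σ {x} {y} ex ey rewrite ex | ey = offset-separates (σ x) (σ y)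

  blockKey-sameBlock : ∀ σ {x y} → inA x ≡ inA y → toℕ (σ x) <ℕ toℕ (σ y) → blockKey σ x <ℕ blockKey σ y
  blockKey-sameBlock σ {x} {y} e σx<σy rewrite e = ℕ.+-monoʳ-< (blockOffset (inA y)) σx<σy

  blockKey-injective : ∀ {σ} → Injective _≡_ _≡_ σ → Injective _≡_ _≡_ (blockKey σ)
  blockKey-injective {σ} σ-inj {x} {y} eq with inA x | inA y
  ... | true  | true  = σ-inj (FinP.toℕ-injective eq)
  ... | false | false = σ-inj (FinP.toℕ-injective (ℕ.+-cancelˡ-≡ n _ _ eq))
  ... | true  | false = ⊥-elim (ℕ.<-irrefl eq (offset-separates (σ x) (σ y)))
  ... | false | true  = ⊥-elim (ℕ.<-irrefl (sym eq) (offset-separates (σ y) (σ x)))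

  blockKey-mono : ∀ σ {x y} → x ≼P y → x ≢ y → blockKey σ x <ℕ blockKey σ y
  blockKey-mono σ x≼y x≢y = let (ex , ey) = ≺⇒A-below-B x≼y x≢y in blockKey-A<B σ ex ey

  blockExt : (σ : Fin n → Fin n) → Injective _≡_ _≡_ σ → LinExt P
  blockExt σ σ-inj = linExtOfKey P (blockKey σ) (blockKey-injective σ-inj) (blockKey-mono σ)

  blockExt-reverses : (σ : Fin n → Fin n) (σ-inj : Injective _≡_ _≡_ σ) {x y : Fin n} →
    blockKey σ y <ℕ blockKey σ x → _>[_]_ P x (blockExt σ σ-inj) y
  blockExt-reverses σ σ-inj =
    linExtOfKey-reverses P (blockKey σ) (blockKey-injective σ-inj) (blockKey-mono σ)

  ascending descending : LinExt P
  ascending  = blockExt id (λ eq → eq)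
  descending = blockExt opposite opposite-injective

  ascending-B-above-A : ∀ {x y} → inA x ≡ false → inA y ≡ true → _>[_]_ P x ascending y
  ascending-B-above-A ex ey = blockExt-reverses id (λ eq → eq) (blockKey-A<B id ey ex)

  sameBlock-reversed : ∀ {x y} → inA x ≡ inA y → x ≢ y →
    _>[_]_ P x ascending y ⊎ _>[_]_ P x descending y
  sameBlock-reversed {x} {y} e x≢y with ℕ.<-cmp (toℕ x) (toℕ y)
  ... | tri< x<y _ _ = inj₂ (blockExt-reverses opposite opposite-injective
                              (blockKey-sameBlock opposite (sym e) (opposite-reverses-< x<y)))
  ... | tri≈ _ x≡y _ = ⊥-elim (x≢y (FinP.toℕ-injective x≡y))
  ... | tri> _ _ y<x = inj₁ (blockExt-reverses id (λ eq → eq) (blockKey-sameBlock id (sym e) y<x))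

  withBlockExts : WFamily P → WFamily P
  withBlockExts F = (ascending , 1ℚ) ∷ (descending , 1ℚ) ∷ F

  totalWeight-withBlockExts : ∀ F → totalWeight P (withBlockExts F) ≡ (1ℚ + 1ℚ) + totalWeight P F
  totalWeight-withBlockExts F = sym (ℚ.+-assoc 1ℚ 1ℚ (totalWeight P F))

  withBlockExts-dimRealizer : ∀ {F} → IdimRealizer P inA F → DimRealizer P (withBlockExts F)
  withBlockExts-dimRealizer {F} (F≥0 , coversAB) = (0≤1 , 0≤1 , F≥0) , reversed
    where
    byAscending : ∀ {x y} → _>[_]_ P x ascending y → 1ℚ ≤ revWeight P (withBlockExts F) x y
    byAscending = revWeight-∷-reversed P ascending 1ℚ _ (0≤1 , F≥0)

    byDescending : ∀ {x y} → _>[_]_ P x descending y → 1ℚ ≤ revWeight P (withBlockExts F) x y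
    byDescending {x} {y} x>y = ℚ.≤-trans (revWeight-∷-reversed P descending 1ℚ F F≥0 x>y)
                                         (revWeight-∷-≥ P ascending _ x y 0≤1)

    byF : ∀ {x y} → 1ℚ ≤ revWeight P F x y → 1ℚ ≤ revWeight P (withBlockExts F) x y
    byF {x} {y} 1≤F = ℚ.≤-trans 1≤F (ℚ.≤-trans (revWeight-∷-≥ P descending F x y 0≤1)
                                               (revWeight-∷-≥ P ascending _ x y 0≤1))

    reversed : ∀ x y → Incomparable P x y → 1ℚ ≤ revWeight P (withBlockExts F) x y
    reversed x y x∥y = byBlocks (inA x) (inA y) refl refl
      where
      sameBlock : inA x ≡ inA y → 1ℚ ≤ revWeight P (withBlockExts F) x y
      sameBlock e = [ byAscending , byDescending ]′ (sameBlock-reversed e (incomparable⇒≢ P x∥y))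

      byBlocks : ∀ b c → inA x ≡ b → inA y ≡ c → 1ℚ ≤ revWeight P (withBlockExts F) x y
      byBlocks true  false ex ey = byF (coversAB x y ex ey x∥y)
      byBlocks false true  ex ey = byAscending (ascending-B-above-A ex ey)
      byBlocks true  true  ex ey = sameBlock (trans ex (sym ey))
      byBlocks false false ex ey = sameBlock (trans ex (sym ey))

proposition4p2 : (n : ℕ) (P : FinPoset n) (inA : Fin n → Bool) → IsBipartite P inA →
    (d : ℚ) → IdimAtMost P inA d → FracDimAtMost P ((1ℚ + 1ℚ) + d)
proposition4p2 n P inA bip d (F , F-realizer , weight≤d) =
  withBlockExts F , withBlockExts-dimRealizer F-realizer ,
  ℚ.≤-trans (ℚ.≤-reflexive (totalWeight-withBlockExts F)) (ℚ.+-monoʳ-≤ (1ℚ + 1ℚ) weight≤d)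
  where open Bipartite P inA bip
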